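{- Let $H$ be a graph with $s$ vertices and minimum degree $\delta$, and let ${\mathcal M}$ be an $H$-matroid on $K_n$ with $n\ge s-1$. Then the rank of ${\mathcal M}$ is at most $(\delta-1)(n-s+1)+\binom{s-1}{2}$.
   Context: An $H$-matroid on a graph $G$ is a matroid on $E(G)$ in which the edge set of every subgraph of $G$ isomorphic to $H$ is a circuit. -}

module Defs where

open import Data.Bool using (Bool; true; false; _∨_)
open import Data.Nat using (ℕ; zero; suc; _≤_; _<_; _∸_; _+_; _*_)
open import Data.Nat.Combinatorics using (_C_)
open import Data.Fin as Fin using (Fin)
open import Data.Fin.Properties using (_<?_)
open import Data.List using (List; []; _∷_; length; filterᵇ; concatMap; filter; map)
open import Data.Product using (Σ; Σ-syntax; _×_; _,_; ∃; ∃-syntax)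
open import Data.Sum using (_⊎_)
open import Function.Bundles using (_⇔_)
open import Function.Definitions using (Injective)
open import Relation.Nullary using (¬_; does)
open import Relation.Binary.PropositionalEquality using (_≡_)

record SimpleGraph (s : ℕ) : Set where
  field
    adj     : Fin s → Fin s → Bool
    sym     : ∀ u v → adj u v ≡ adj v u
    irrefl  : ∀ v → adj v v ≡ false

open SimpleGraph public

allVertices : (s : ℕ) → List (Fin s)
allVertices s = Data.List.allFin s

degree : ∀ {s} → SimpleGraph s → Fin s → ℕ
degree {s} H v = length (filterᵇ (adj H v) (allVertices s))

IsMinDegree : ∀ {s} → SimpleGraph s → ℕ → Set
IsMinDegree {s} H δ = (∃[ v ] degree H v ≡ δ) × (∀ v → δ ≤ degree H v)

record Edge (n : ℕ) : Set where
  constructor edge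
  field
    u v : Fin n
    .lt : u Fin.< v

allEdges : (n : ℕ) → List (Edge n)
allEdges n = concatMap (λ i → concatMap (λ j → pairs i j (i <? j)) (allVertices n)) (allVertices n)
  where
  open import Relation.Nullary using (Dec; yes; no)
  pairs : (i j : Fin n) → Dec (i Fin.< j) → List (Edge n)
  pairs i j (yes p) = edge i j p ∷ []
  pairs i j (no _)  = []

EdgeSet : ℕ → Set
EdgeSet n = Edge n → Bool

_∈ₑ_ : ∀ {n} → Edge n → EdgeSet n → Set
e ∈ₑ X = X e ≡ true

_⊆ₑ_ : ∀ {n} → EdgeSet n → EdgeSet n → Set
X ⊆ₑ Y = ∀ e → e ∈ₑ X → e ∈ₑ Y

size : ∀ {n} → EdgeSet n → ℕ
size {n} X = length (filterᵇ X (allEdges n))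

record Matroid (n : ℕ) : Set₁ where
  field
    Indep      : EdgeSet n → Set
    indep-∅    : Indep (λ _ → false)
    indep-⊆    : ∀ X Y → X ⊆ₑ Y → Indep Y → Indep X
    -- augmentation: X ∪ {e} is any Z with Z = X ∪ {e} extensionally
    augment    : ∀ X Y → Indep X → Indep Y → size X < size Y →
                 Σ[ e ∈ Edge n ] (e ∈ₑ Y × X e ≡ false ×
                   (∀ Z → (∀ e' → (e' ∈ₑ Z) ⇔ (e' ∈ₑ X ⊎ e' ≡ e)) → Indep Z))

open Matroid public

IsCircuit : ∀ {n} → Matroid n → EdgeSet n → Set
IsCircuit M C = ¬ Indep M C ×
  (∀ D → D ⊆ₑ C → (∃[ e ] (e ∈ₑ C × D e ≡ false)) → Indep M D)

IsCopyEdgeSet : ∀ {s n} → SimpleGraph s → (Fin s → Fin n) → EdgeSet n → Set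
IsCopyEdgeSet {s} H f X = ∀ e →
  (e ∈ₑ X) ⇔ (∃[ a ] ∃[ b ] (adj H a b ≡ true × f a ≡ Edge.u e × f b ≡ Edge.v e))

IsHMatroid : ∀ {s n} → SimpleGraph s → Matroid n → Set
IsHMatroid {s} {n} H M = ∀ (f : Fin s → Fin n) → Injective _≡_ _≡_ f →
  ∀ X → IsCopyEdgeSet H f X → IsCircuit M X

RankAtMost : ∀ {n} → Matroid n → ℕ → Set
RankAtMost M r = ∀ X → Indep M X → size X ≤ r

module Submission where

-- Add the edges of K_n column by column, column j being the edges {i, j} with i < j. The first
-- s - 1 columns hold C(s - 1, 2) edges in all. Fix a vertex w of H of minimum degree δ and a
-- neighbour a of w, and number H - w once and for all by 0, ..., s - 2; let F be the numbers of
-- the δ - 1 neighbours of w other than a. In any later column j, the edges {f, j} with f ∈ F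
-- raise the rank by at most δ - 1, after which every other edge {i, j} of the column is spanned:
-- sending w to j and a to i (swapping a's number with i) embeds H as a circuit through {i, j}
-- all of whose other edges are earlier or of the form {f, j}.

open import Defs hiding (sym)
open import Data.Bool using (Bool; true; false; if_then_else_; T?)
open import Data.Bool.Properties using (T-≡) renaming (_≟_ to _≟ᵇ_)
open import Data.Fin as Fin using (Fin; toℕ; fromℕ; fromℕ<; inject≤)
open import Data.Fin.Permutation.Components using (transpose; transpose-inverse)
open import Data.Fin.Properties
  using (any?; toℕ-injective; toℕ-fromℕ; toℕ-fromℕ<; toℕ-inject≤; toℕ<n; inject≤-injective)
  renaming (_≟_ to _≟ᶠ_; _<?_ to _<ᶠ?_)
open import Data.List using (List; []; _∷_; length; filter; filterᵇ; concatMap; map; allFin; upTo)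
open import Data.List.Membership.Propositional using (_∈_; _∉_)
open import Data.List.Membership.Propositional.Properties
  using (∈-concatMap⁺; ∈-concatMap⁻; ∈-allFin; ∈-map⁺; ∈-filter⁺; ∈-upTo⁺)
open import Data.List.Properties using (filter-none; concatMap-cong; length-map; length-upTo)
open import Data.List.Relation.Binary.Sublist.Propositional using (⊆-refl)
open import Data.List.Relation.Binary.Sublist.Propositional.Properties using (filter⁺; length-mono-≤)
open import Data.List.Relation.Unary.All as All using ()
open import Data.List.Relation.Unary.All.Properties as All using ()
open import Data.List.Relation.Unary.AllPairs as AllPairs using ([]; _∷_)
open import Data.List.Relation.Unary.AllPairs.Properties as AllPairs using ()
open import Data.List.Relation.Unary.Any as Any using (here; there)
open import Data.List.Relation.Unary.Unique.Propositional using (Unique)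
open import Data.List.Relation.Unary.Unique.Propositional.Properties using (concat⁺; allFin⁺)
open import Data.Nat using (ℕ; zero; suc; _≤_; _<_; _∸_; _+_; _*_; z≤n; s≤s; s≤s⁻¹; _≤?_; _<?_)
open import Data.Nat.Combinatorics using (_C_; nC1≡n; nCk+nC[k+1]≡[n+1]C[k+1])
open import Data.Nat.Properties
  using (≤-refl; ≤-reflexive; ≤-trans; <-trans; <-≤-trans; ≤-<-trans; <-irrefl; <⇒≤; <⇒≢; ≰⇒>;
         ≤∧≢⇒<; m<1+n⇒m<n∨m≡n; m≤n⇒m≤1+n; n≤1+n; m≤m+n; m≤n+m; m∸n+n≡m;
         +-identityʳ; +-suc; +-comm; +-assoc; *-comm; +-monoˡ-≤; +-monoʳ-≤; *-monoʳ-≤)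
open import Data.Product using (∃-syntax; Σ-syntax; _×_; _,_; proj₁; proj₂; uncurry)
open import Data.Sum using (_⊎_; inj₁; inj₂; [_,_])
open import Function using (_∘_; id)
open import Function.Bundles using (Equivalence; _⇔_; mk⇔)
open import Function.Definitions using (Injective)
open import Level using (0ℓ)
open import Relation.Binary.Definitions using (DecidableEquality)
open import Relation.Binary.PropositionalEquality
  using (_≡_; _≢_; refl; sym; trans; cong; subst; subst₂)
open import Relation.Nullary using (¬_; Dec; yes; no; does; contradiction)
open import Relation.Nullary.Decidable using (dec-true; dec-false; recompute; map′; _×-dec_)
open import Relation.Unary using (Pred; Empty; _⊆′_; _∪_; ｛_｝)
open import Data.List.Membership.DecPropositional Data.Nat._≟_ using (_∈?_)

open Equivalence using (to; from)

module _ {A : Set} where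

  filterᵇ-nonempty : {p : A → Bool} → ∀ xs → 0 < length (filterᵇ p xs) → ∃[ x ] p x ≡ true
  filterᵇ-nonempty {p} (x ∷ xs) nonempty with p x in px
  ... | true  = x , px
  ... | false = filterᵇ-nonempty xs nonempty

  length-filterᵇ-mono : {p q : A → Bool} → (∀ x → p x ≡ true → q x ≡ true) →
    ∀ xs → length (filterᵇ p xs) ≤ length (filterᵇ q xs)
  length-filterᵇ-mono p⇒q xs =
    length-mono-≤ (filter⁺ _ _ (λ { {x} refl px → from T-≡ (p⇒q x (to T-≡ px)) }) (⊆-refl {x = xs}))

  length-filterᵇ-< : {p q : A → Bool} → (∀ x → p x ≡ true → q x ≡ true) →
    ∀ {x xs} → x ∈ xs → p x ≡ false → q x ≡ true → length (filterᵇ p xs) < length (filterᵇ q xs)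
  length-filterᵇ-< p⇒q {xs = _ ∷ xs} (here refl) px qx rewrite px | qx =
    s≤s (length-filterᵇ-mono p⇒q xs)
  length-filterᵇ-< {p} {q} p⇒q {xs = y ∷ _} (there x∈xs) px qx with p y in py | q y in qy
  ... | true  | true  = s≤s (length-filterᵇ-< p⇒q x∈xs px qx)
  ... | true  | false = contradiction (trans (sym (p⇒q y py)) qy) λ ()
  ... | false | true  = m≤n⇒m≤1+n (length-filterᵇ-< p⇒q x∈xs px qx)
  ... | false | false = length-filterᵇ-< p⇒q x∈xs px qx

module Indicator {A : Set} (_≟_ : DecidableEquality A) where

  remove insert : (A → Bool) → A → A → Bool
  remove p x y = if does (y ≟ x) then false else p y
  insert p x y = if does (y ≟ x) then true else p y

  remove-self : ∀ p x → remove p x x ≡ false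
  remove-self p x = cong (if_then false else p x) (dec-true (x ≟ x) refl)

  remove⁻ : ∀ p x {y} → remove p x y ≡ true → p y ≡ true × y ≢ x
  remove⁻ p x {y} py with y ≟ x
  ... | no y≢x = py , y≢x

  remove⁺ : ∀ p x {y} → p y ≡ true → y ≢ x → remove p x y ≡ true
  remove⁺ p x {y} py y≢x with y ≟ x
  ... | yes y≡x = contradiction y≡x y≢x
  ... | no _    = py

  insert⇔ : ∀ p x y → (insert p x y ≡ true) ⇔ (p y ≡ true ⊎ y ≡ x)
  insert⇔ p x y with y ≟ x
  ... | yes y≡x = mk⇔ (λ _ → inj₂ y≡x) (λ _ → refl)
  ... | no y≢x  = mk⇔ inj₁ [ id , (λ y≡x → contradiction y≡x y≢x) ]

  length-filterᵇ-remove : ∀ p x xs →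
    length (filterᵇ p xs) ≤ length (filter (_≟ x) xs) + length (filterᵇ (remove p x) xs)
  length-filterᵇ-remove p x [] = z≤n
  length-filterᵇ-remove p x (y ∷ xs) with y ≟ x | p y
  ... | yes refl | true  = s≤s (length-filterᵇ-remove p x xs)
  ... | yes refl | false = m≤n⇒m≤1+n (length-filterᵇ-remove p x xs)
  ... | no _     | true  = ≤-trans (s≤s (length-filterᵇ-remove p x xs)) (≤-reflexive (sym (+-suc _ _)))
  ... | no _     | false = length-filterᵇ-remove p x xs

  length-filter-≡-≤1 : ∀ x {xs} → Unique xs → length (filter (_≟ x) xs) ≤ 1
  length-filter-≡-≤1 x {[]} _ = z≤n
  length-filter-≡-≤1 x {y ∷ xs} (y∉xs ∷ xs!) with y ≟ x
  ... | yes refl = ≤-reflexive (cong (suc ∘ length) (filter-none (_≟ x) (All.map (_∘ sym) y∉xs)))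
  ... | no _     = length-filter-≡-≤1 x xs!

module _ {A B : Set} where

  Unique-concatMap : {f : A → List B} (key : B → A) → (∀ {x b} → b ∈ f x → key b ≡ x) →
    (∀ x → Unique (f x)) → ∀ {xs} → Unique xs → Unique (concatMap f xs)
  Unique-concatMap {f} key key-f f! {xs} xs! =
    concat⁺ (All.map⁺ (All.universal f! xs))
            (AllPairs.map⁺ (AllPairs.map disjoint xs!))
    where
    disjoint : ∀ {x y} → x ≢ y → ∀ {b} → ¬ (b ∈ f x × b ∈ f y)
    disjoint x≢y (b∈fx , b∈fy) = x≢y (trans (sym (key-f b∈fx)) (key-f b∈fy))

module _ {n : ℕ} where

  edge-u<v : (e : Edge n) → toℕ (Edge.u e) < toℕ (Edge.v e)
  edge-u<v (edge u v u<v) = recompute (u <ᶠ? v) u<v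

  edge-≡ : {e e′ : Edge n} → Edge.u e ≡ Edge.u e′ → Edge.v e ≡ Edge.v e′ → e ≡ e′
  edge-≡ {edge u v _} {edge _ _ _} refl refl = refl

  _≟ₑ_ : DecidableEquality (Edge n)
  e ≟ₑ e′ = map′ (uncurry edge-≡) (λ eq → cong Edge.u eq , cong Edge.v eq)
                 (Edge.u e ≟ᶠ Edge.u e′ ×-dec Edge.v e ≟ᶠ Edge.v e′)

  edgeAt : {i j : ℕ} → i < j → j < n → Edge n
  edgeAt i<j j<n = edge (fromℕ< (<-trans i<j j<n)) (fromℕ< j<n)
    (subst₂ _<_ (sym (toℕ-fromℕ< (<-trans i<j j<n))) (sym (toℕ-fromℕ< j<n)) i<j)

  edgeAt-unique : ∀ {i j} (i<j : i < j) (j<n : j < n) {e : Edge n} →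
    toℕ (Edge.u e) ≡ i → toℕ (Edge.v e) ≡ j → e ≡ edgeAt i<j j<n
  edgeAt-unique i<j j<n u≡i v≡j =
    edge-≡ (toℕ-injective (trans u≡i (sym (toℕ-fromℕ< (<-trans i<j j<n)))))
           (toℕ-injective (trans v≡j (sym (toℕ-fromℕ< j<n))))

  edgeIf : (i j : Fin n) → Dec (i Fin.< j) → List (Edge n)
  edgeIf i j (yes i<j) = edge i j i<j ∷ []
  edgeIf i j (no _)    = []

  edgeList : List (Edge n)
  edgeList = concatMap (λ i → concatMap (λ j → edgeIf i j (i <ᶠ? j)) (allFin n)) (allFin n)

  -- `allEdges` enumerates with a function local to `Defs`: the `_` is that function,
  -- solved by unification in `allEdges≡edgeList` before the clauses below are checked.
  pairs≡edgeIf : (i j : Fin n) → _ ≡ edgeIf i j (i <ᶠ? j)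

  allEdges≡edgeList : allEdges n ≡ edgeList
  allEdges≡edgeList = concatMap-cong (λ i → concatMap-cong (pairs≡edgeIf i) (allFin n)) (allFin n)

  pairs≡edgeIf i j with i <ᶠ? j
  ... | yes _ = refl
  ... | no _  = refl

  ∈-edgeIf⁻ : ∀ {i j} d {e} → e ∈ edgeIf i j d → Edge.u e ≡ i × Edge.v e ≡ j
  ∈-edgeIf⁻ (yes _) (here refl) = refl , refl

  edgeIf-unique : ∀ i j d → Unique (edgeIf i j d)
  edgeIf-unique i j (yes _) = All.[] ∷ []
  edgeIf-unique i j (no _)  = []

  edgeList-unique : Unique edgeList
  edgeList-unique = Unique-concatMap Edge.u ∈-row⁻ row-unique (allFin⁺ n)
    where
    row : Fin n → List (Edge n)
    row i = concatMap (λ j → edgeIf i j (i <ᶠ? j)) (allFin n)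

    ∈-row⁻ : ∀ {i e} → e ∈ row i → Edge.u e ≡ i
    ∈-row⁻ {i} e∈row
      with j , e∈ ← Any.satisfied (∈-concatMap⁻ (λ j → edgeIf i j (i <ᶠ? j)) {xs = allFin n} e∈row)
      = proj₁ (∈-edgeIf⁻ (i <ᶠ? j) e∈)

    row-unique : ∀ i → Unique (row i)
    row-unique i = Unique-concatMap Edge.v (λ {j} → proj₂ ∘ ∈-edgeIf⁻ (i <ᶠ? j))
      (λ j → edgeIf-unique i j (i <ᶠ? j)) (allFin⁺ n)

  ∈-edgeList : (e : Edge n) → e ∈ edgeList
  ∈-edgeList (edge u v u<v) =
    ∈-concatMap⁺ _ (Any.map (λ { refl → ∈-concatMap⁺ _ (Any.map (λ { refl → ∈-edgeIf (u <ᶠ? v) })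
                                                               (∈-allFin v)) })
                           (∈-allFin u))
    where
    ∈-edgeIf : (d : Dec (u Fin.< v)) → edge u v u<v ∈ edgeIf u v d
    ∈-edgeIf (yes _)   = here refl
    ∈-edgeIf (no u≮v) = contradiction (recompute (u <ᶠ? v) u<v) u≮v

  open Indicator _≟ₑ_ public using ()
    renaming (remove to _-ₑ_; insert to _+ₑ_; remove-self to ∉-ₑ; remove⁻ to ∈-ₑ⁻; remove⁺ to ∈-ₑ⁺;
              insert⇔ to ∈-+ₑ)

  ∈-allEdges : (e : Edge n) → e ∈ allEdges n
  ∈-allEdges e = subst (e ∈_) (sym allEdges≡edgeList) (∈-edgeList e)

  size-+ₑ : ∀ X {e} → X e ≡ false → size X < size (X +ₑ e)
  size-+ₑ X {e} e∉X = length-filterᵇ-< (λ e′ e′∈X → from (∈-+ₑ X e e′) (inj₁ e′∈X))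
    (∈-allEdges e) e∉X (from (∈-+ₑ X e e) (inj₂ refl))

  size≤1+size-ₑ : ∀ X e → size X ≤ suc (size (X -ₑ e))
  size≤1+size-ₑ X e = ≤-trans (Indicator.length-filterᵇ-remove _≟ₑ_ X e (allEdges n))
    (+-monoˡ-≤ (size (X -ₑ e)) (Indicator.length-filter-≡-≤1 _≟ₑ_ e allEdges-unique))
    where
    allEdges-unique : Unique (allEdges n)
    allEdges-unique = subst Unique (sym allEdges≡edgeList) edgeList-unique

  size-empty : ∀ X → (∀ e → ¬ e ∈ₑ X) → size X ≡ 0
  size-empty X ∉X = cong length (filter-none _ (All.universal (λ e → ∉X e ∘ to T-≡) (allEdges n)))

-- Rank bounds in a matroid on E(K_n)

module _ {n : ℕ} (M : Matroid n) where

  private variable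
    S S′ T : Pred (Edge n) 0ℓ
    r r′ : ℕ
    e : Edge n

  RankAtMostOn : Pred (Edge n) 0ℓ → ℕ → Set
  RankAtMostOn S r = ∀ J → Indep M J → (_∈ₑ J) ⊆′ S → size J ≤ r

  CircuitSpans : Pred (Edge n) 0ℓ → Edge n → Set
  CircuitSpans S e = Σ[ Z ∈ EdgeSet n ] IsCircuit M Z × e ∈ₑ Z × (_∈ₑ Z) ⊆′ S ∪ ｛ e ｝

  circuitSpans-mono : S ⊆′ T → CircuitSpans S e → CircuitSpans T e
  circuitSpans-mono S⊆T (Z , circuit , e∈Z , Z⊆) =
    Z , circuit , e∈Z , λ e′ e′∈Z → [ inj₁ ∘ S⊆T e′ , inj₂ ] (Z⊆ e′ e′∈Z)

  augment-+ₑ : ∀ {X Y} → Indep M X → Indep M Y → size X < size Y →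
    Σ[ f ∈ Edge n ] f ∈ₑ Y × X f ≡ false × Indep M (X +ₑ f)
  augment-+ₑ {X} {Y} indX indY X<Y with augment M X Y indX indY X<Y
  ... | f , f∈Y , f∉X , ind = f , f∈Y , f∉X , ind (X +ₑ f) (∈-+ₑ X f)

  circuit-ₑ-indep : ∀ {Z} → IsCircuit M Z → e ∈ₑ Z → Indep M (Z -ₑ e)
  circuit-ₑ-indep {e} {Z} (_ , minimal) e∈Z =
    minimal (Z -ₑ e) (λ _ → proj₁ ∘ ∈-ₑ⁻ Z e) (e , e∈Z , ∉-ₑ Z e)

  rankOn-empty : Empty S → RankAtMostOn S 0
  rankOn-empty ∅S J _ J⊆S = ≤-reflexive (size-empty J (λ e → ∅S e ∘ J⊆S e))

  rankOn-mono : S′ ⊆′ S → r ≤ r′ → RankAtMostOn S r → RankAtMostOn S′ r′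
  rankOn-mono S′⊆S r≤r′ rankS J indJ J⊆S′ = ≤-trans (rankS J indJ (λ e → S′⊆S e ∘ J⊆S′ e)) r≤r′

  private
    ∈-∪-｛｝⁻ : ∀ {e′} → S e′ ⊎ e ≡ e′ → e′ ≢ e → S e′
    ∈-∪-｛｝⁻ e′∈ e′≢e = [ id , (λ e≡e′ → contradiction (sym e≡e′) e′≢e) ] e′∈

  rankOn-insert : S′ ⊆′ S ∪ ｛ e ｝ → RankAtMostOn S r → RankAtMostOn S′ (suc r)
  rankOn-insert {S = S} {e = e} S′⊆ rankS J indJ J⊆S′ =
    ≤-trans (size≤1+size-ₑ J e) (s≤s (rankS (J -ₑ e) indJ′ J′⊆S))
    where
    indJ′ : Indep M (J -ₑ e)
    indJ′ = indep-⊆ M (J -ₑ e) J (λ _ → proj₁ ∘ ∈-ₑ⁻ J e) indJ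
    J′⊆S : (_∈ₑ (J -ₑ e)) ⊆′ S
    J′⊆S e′ e′∈J′ = let e′∈J , e′≢e = ∈-ₑ⁻ J e e′∈J′ in ∈-∪-｛｝⁻ {S = S} (S′⊆ e′ (J⊆S′ e′ e′∈J)) e′≢e

  rankOn-spanned : S′ ⊆′ S ∪ ｛ e ｝ → CircuitSpans S e → RankAtMostOn S r → RankAtMostOn S′ r
  rankOn-spanned {S′ = S′} {S = S} {e = e} {r = r} S′⊆ (Z , circuit , e∈Z , Z⊆) rankS J indJ J⊆S′ =
    grow (size J) (Z -ₑ e) (circuit-ₑ-indep circuit e∈Z) Z-e⊆S (λ _ → id) (m≤m+n (size J) _)
    where
    Z-e⊆S : (_∈ₑ (Z -ₑ e)) ⊆′ S
    Z-e⊆S e′ e′∈ = let e′∈Z , e′≢e = ∈-ₑ⁻ Z e e′∈ in ∈-∪-｛｝⁻ {S = S} (Z⊆ e′ e′∈Z) e′≢e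
    -- K grows towards J inside S by augmentation; it can never absorb e, since it contains Z - e.
    grow : ∀ k K → Indep M K → (_∈ₑ K) ⊆′ S → (Z -ₑ e) ⊆ₑ K → size J ≤ k + size K → size J ≤ r
    grow k K indK K⊆S Z-e⊆K J≤k+K with size J ≤? size K
    ... | yes J≤K = ≤-trans J≤K (rankS K indK K⊆S)
    grow zero K _ _ _ J≤K | no J≰K = contradiction J≤K J≰K
    grow (suc k) K indK K⊆S Z-e⊆K J≤k+K | no J≰K with augment-+ₑ indK indJ (≰⇒> J≰K)
    ... | f , f∈J , f∉K , indK+f with f ≟ₑ e
    ...   | yes refl = contradiction (indep-⊆ M Z (K +ₑ e) Z⊆K+e indK+f) (proj₁ circuit)
      where
      Z⊆K+e : Z ⊆ₑ (K +ₑ e)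
      Z⊆K+e e′ e′∈Z with e′ ≟ₑ e
      ... | yes e′≡e = from (∈-+ₑ K e e′) (inj₂ e′≡e)
      ... | no e′≢e  = from (∈-+ₑ K e e′) (inj₁ (Z-e⊆K e′ (∈-ₑ⁺ Z e e′∈Z e′≢e)))
    ...   | no f≢e = grow k (K +ₑ f) indK+f K+f⊆S
                       (λ e′ → from (∈-+ₑ K f e′) ∘ inj₁ ∘ Z-e⊆K e′)
                       (≤-trans J≤k+K (≤-trans (≤-reflexive (sym (+-suc k (size K))))
                                                (+-monoʳ-≤ k (size-+ₑ K f∉K))))
      where
      K+f⊆S : (_∈ₑ (K +ₑ f)) ⊆′ S
      K+f⊆S e′ e′∈ with to (∈-+ₑ K f e′) e′∈
      ... | inj₁ e′∈K = K⊆S e′ e′∈K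
      ... | inj₂ refl = ∈-∪-｛｝⁻ {S = S} (S′⊆ f (J⊆S′ f f∈J)) f≢e

module _ {n : ℕ} where

  Below : ℕ → Pred (Edge n) 0ℓ
  Below j e = toℕ (Edge.v e) < j

  Column : ℕ → Pred ℕ 0ℓ → Pred (Edge n) 0ℓ
  Column j Q e = toℕ (Edge.v e) ≡ j × Q (toℕ (Edge.u e))

  module _ (M : Matroid n) {j : ℕ} (j<n : j < n) where

    rankOn-addColumn : ∀ {r} L → RankAtMostOn M (Below j) r →
      RankAtMostOn M (Below j ∪ Column j (_∈ L)) (r + length L)
    rankOn-addColumn {r} [] rank =
      rankOn-mono M (λ _ → [ id , (λ { (_ , ()) }) ]) (≤-reflexive (sym (+-identityʳ r))) rank
    rankOn-addColumn {r} (x ∷ L) rank with x <? j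
    ... | yes x<j = rankOn-mono M (λ _ → id) (≤-reflexive (sym (+-suc r (length L))))
                      (rankOn-insert M new-edge (rankOn-addColumn L rank))
      where
      new-edge : Below j ∪ Column j (_∈ x ∷ L) ⊆′ (Below j ∪ Column j (_∈ L)) ∪ ｛ edgeAt x<j j<n ｝
      new-edge _ (inj₁ e∈Below)             = inj₁ (inj₁ e∈Below)
      new-edge _ (inj₂ (v≡j , here u≡x))    = inj₂ (sym (edgeAt-unique x<j j<n u≡x v≡j))
      new-edge _ (inj₂ (v≡j , there u∈L))   = inj₁ (inj₂ (v≡j , u∈L))
    ... | no x≮j = rankOn-mono M no-edge (+-monoʳ-≤ r (n≤1+n (length L))) (rankOn-addColumn L rank)
      where
      no-edge : Below j ∪ Column j (_∈ x ∷ L) ⊆′ Below j ∪ Column j (_∈ L)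
      no-edge _ (inj₁ e∈Below)              = inj₁ e∈Below
      no-edge e (inj₂ (v≡j , here u≡x))     = contradiction (subst₂ _<_ u≡x v≡j (edge-u<v e)) x≮j
      no-edge _ (inj₂ (v≡j , there u∈L))    = inj₂ (v≡j , u∈L)

    rankOn-spannedColumn : ∀ {r L} →
      (∀ {i} (i<j : i < j) → i ∉ L → CircuitSpans M (Below j ∪ Column j (_∈ L)) (edgeAt i<j j<n)) →
      RankAtMostOn M (Below j ∪ Column j (_∈ L)) r → RankAtMostOn M (Below (suc j)) r
    rankOn-spannedColumn {r} {L} spans rank = rankOn-mono M below-suc ≤-refl (prefix j)
      where
      Prefix : ℕ → Pred (Edge n) 0ℓ
      Prefix i = Below j ∪ Column j (λ u → u ∈ L ⊎ u < i)

      extend : ∀ {i} {T : Pred (Edge n) 0ℓ} → Prefix i ⊆′ T → Column j (_≡ i) ⊆′ T → Prefix (suc i) ⊆′ T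
      extend old new e (inj₁ e∈Below)           = old e (inj₁ e∈Below)
      extend old new e (inj₂ (v≡j , inj₁ u∈L))  = old e (inj₂ (v≡j , inj₁ u∈L))
      extend old new e (inj₂ (v≡j , inj₂ u<1+i)) with m<1+n⇒m<n∨m≡n u<1+i
      ... | inj₁ u<i = old e (inj₂ (v≡j , inj₂ u<i))
      ... | inj₂ u≡i = new e (v≡j , u≡i)

      start : Prefix 0 ⊆′ Below j ∪ Column j (_∈ L)
      start _ (inj₁ e∈Below)          = inj₁ e∈Below
      start _ (inj₂ (v≡j , inj₁ u∈L)) = inj₂ (v≡j , u∈L)

      prefix : ∀ i → RankAtMostOn M (Prefix i) r
      prefix zero = rankOn-mono M start ≤-refl rank
      prefix (suc i) with i ∈? L | i <? j
      ... | yes i∈L | _ = rankOn-mono M (extend (λ _ → id) in-L) ≤-refl (prefix i)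
        where
        in-L : Column j (_≡ i) ⊆′ Prefix i
        in-L _ (v≡j , refl) = inj₂ (v≡j , inj₁ i∈L)
      ... | no i∉L | yes i<j = rankOn-spanned M (extend (λ _ → inj₁) is-edgeAt)
                                 (circuitSpans-mono M old⊆prefix (spans i<j i∉L)) (prefix i)
        where
        is-edgeAt : Column j (_≡ i) ⊆′ Prefix i ∪ ｛ edgeAt i<j j<n ｝
        is-edgeAt _ (v≡j , u≡i) = inj₂ (sym (edgeAt-unique i<j j<n u≡i v≡j))
        old⊆prefix : Below j ∪ Column j (_∈ L) ⊆′ Prefix i
        old⊆prefix _ (inj₁ e∈Below)      = inj₁ e∈Below
        old⊆prefix _ (inj₂ (v≡j , u∈L)) = inj₂ (v≡j , inj₁ u∈L)
      ... | no _ | no i≮j = rankOn-mono M (extend (λ _ → id) empty) ≤-refl (prefix i)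
        where
        empty : Column j (_≡ i) ⊆′ Prefix i
        empty e (v≡j , u≡i) = contradiction (subst₂ _<_ u≡i v≡j (edge-u<v e)) i≮j

      below-suc : Below (suc j) ⊆′ Prefix j
      below-suc e v<1+j with m<1+n⇒m<n∨m≡n v<1+j
      ... | inj₁ v<j = inj₁ v<j
      ... | inj₂ v≡j = inj₂ (v≡j , inj₂ (subst (toℕ (Edge.u e) <_) v≡j (edge-u<v e)))

rankOn-Below : ∀ {n} (M : Matroid n) j → j ≤ n → RankAtMostOn M (Below j) (j C 2)
rankOn-Below M zero _ = rankOn-empty M (λ _ ())
rankOn-Below M (suc j) j<n =
  rankOn-spannedColumn M j<n (λ i<j i∉ → contradiction (∈-upTo⁺ i<j) i∉)
    (rankOn-mono M (λ _ → id) (≤-reflexive pascal)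
      (rankOn-addColumn M j<n (upTo j) (rankOn-Below M j (<⇒≤ j<n))))
  where
  pascal : j C 2 + length (upTo j) ≡ suc j C 2
  pascal = trans (+-comm (j C 2) (length (upTo j)))
    (trans (cong (_+ j C 2) (trans (length-upTo j) (sym (nC1≡n j)))) (nCk+nC[k+1]≡[n+1]C[k+1] j 1))

rankAtMost-Below : ∀ {n r} (M : Matroid n) → RankAtMostOn M (Below n) r → RankAtMost M r
rankAtMost-Below M rank X indX = rank X indX (λ e _ → toℕ<n (Edge.v e))

-- Copies of H

module _ {m : ℕ} where

  transpose-matchˡ : (i j : Fin m) → transpose i j i ≡ j
  transpose-matchˡ i j rewrite dec-true (i ≟ᶠ i) refl = refl

  transpose-mismatch : {i j k : Fin m} → k ≢ i → k ≢ j → transpose i j k ≡ k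
  transpose-mismatch {i} {j} {k} k≢i k≢j
    rewrite dec-false (k ≟ᶠ i) k≢i | dec-false (k ≟ᶠ j) k≢j = refl

  transpose-cases : (i j k : Fin m) → transpose i j k ≡ j ⊎ transpose i j k ≡ i ⊎ transpose i j k ≡ k
  transpose-cases i j k with does (k ≟ᶠ i)
  ... | true = inj₁ refl
  ... | false with does (k ≟ᶠ j)
  ...   | true  = inj₂ (inj₁ refl)
  ...   | false = inj₂ (inj₂ refl)

  transpose-injective : (i j : Fin m) {k l : Fin m} → transpose i j k ≡ transpose i j l → k ≡ l
  transpose-injective i j eq =
    trans (sym (transpose-inverse j i)) (trans (cong (transpose j i) eq) (transpose-inverse j i))

does⇔ : {A : Set} (a? : Dec A) → (does a? ≡ true) ⇔ A
does⇔ (yes a)  = mk⇔ (λ _ → a) (λ _ → refl)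
does⇔ (no ¬a) = mk⇔ (λ ()) (λ a → contradiction a ¬a)

adj⇒≢ : ∀ {s} (H : SimpleGraph s) {x y} → adj H x y ≡ true → x ≢ y
adj⇒≢ H {x} x~y refl = contradiction (trans (sym x~y) (irrefl H x)) λ ()

module _ {s n : ℕ} (H : SimpleGraph s) (f : Fin s → Fin n) where

  copy? : (e : Edge n) → Dec (∃[ a ] ∃[ b ] (adj H a b ≡ true × f a ≡ Edge.u e × f b ≡ Edge.v e))
  copy? e = any? λ a → any? λ b → (adj H a b ≟ᵇ true) ×-dec (f a ≟ᶠ Edge.u e) ×-dec (f b ≟ᶠ Edge.v e)

  copyOf : EdgeSet n
  copyOf e = does (copy? e)

  copyOf-isCopy : IsCopyEdgeSet H f copyOf
  copyOf-isCopy e = does⇔ (copy? e)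

module _ {s′ : ℕ} (H : SimpleGraph (suc s′)) {w a : Fin (suc s′)} (w~a : adj H w a ≡ true) where

  relabel : Fin (suc s′) → Fin (suc s′)
  relabel = transpose w (fromℕ s′)

  position : Fin (suc s′) → ℕ
  position c = toℕ (relabel c)

  position-injective : ∀ {c c′} → position c ≡ position c′ → c ≡ c′
  position-injective = transpose-injective w (fromℕ s′) ∘ toℕ-injective

  position-w : position w ≡ s′
  position-w = trans (cong toℕ (transpose-matchˡ w (fromℕ s′))) (toℕ-fromℕ s′)

  position-< : ∀ {c} → c ≢ w → position c < s′
  position-< {c} c≢w =
    ≤∧≢⇒< (s≤s⁻¹ (toℕ<n (relabel c))) (λ eq → c≢w (position-injective (trans eq (sym position-w))))

  otherNeighbours : List (Fin (suc s′))
  otherNeighbours = filterᵇ (Indicator.remove _≟ᶠ_ (adj H w) a) (allFin (suc s′))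

  freePositions : List ℕ
  freePositions = map position otherNeighbours

  ∈-freePositions : ∀ {c} → adj H w c ≡ true → c ≢ a → position c ∈ freePositions
  ∈-freePositions {c} w~c c≢a = ∈-map⁺ position (∈-filter⁺ (T? ∘ Indicator.remove _≟ᶠ_ (adj H w) a) (∈-allFin c)
    (from T-≡ (Indicator.remove⁺ _≟ᶠ_ (adj H w) a w~c c≢a)))

  length-freePositions : length freePositions < degree H w
  length-freePositions = subst (_< degree H w) (sym (length-map position otherNeighbours))
    (length-filterᵇ-< (λ _ → proj₁ ∘ Indicator.remove⁻ _≟ᶠ_ (adj H w) a) (∈-allFin a)
      (Indicator.remove-self _≟ᶠ_ (adj H w) a) w~a)

  module _ {n : ℕ} (M : Matroid n) (hM : IsHMatroid H M)
           {i j : ℕ} (i<j : i < j) (j<n : j < n) (s′≤j : s′ ≤ j) where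

    private
      e₀ : Edge n
      e₀ = edgeAt i<j j<n

      toℕ-u₀ : toℕ (Edge.u e₀) ≡ i
      toℕ-u₀ = toℕ-fromℕ< (<-trans i<j j<n)

      toℕ-v₀ : toℕ (Edge.v e₀) ≡ j
      toℕ-v₀ = toℕ-fromℕ< j<n

    ι : Fin (suc s′) → Fin n
    ι c = inject≤ (relabel c) (≤-<-trans s′≤j j<n)

    toℕ-ι : ∀ c → toℕ (ι c) ≡ position c
    toℕ-ι c = toℕ-inject≤ (relabel c) _

    ι-injective : ∀ {c c′} → ι c ≡ ι c′ → c ≡ c′
    ι-injective = transpose-injective w (fromℕ s′) ∘ inject≤-injective _ _ _ _

    ι-<j : ∀ {c} → c ≢ w → toℕ (ι c) < j
    ι-<j {c} c≢w = subst (_< j) (sym (toℕ-ι c)) (<-≤-trans (position-< c≢w) s′≤j)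

    ι≢v₀ : ∀ {c} → c ≢ w → ι c ≢ Edge.v e₀
    ι≢v₀ c≢w eq = <-irrefl (trans (cong toℕ eq) toℕ-v₀) (ι-<j c≢w)

    -- ι puts H - w below s′ and w at s′; the two transpositions then move w to j and a to i.
    embed : Fin (suc s′) → Fin n
    embed = transpose (ι a) (Edge.u e₀) ∘ transpose (ι w) (Edge.v e₀) ∘ ι

    embed-injective : Injective _≡_ _≡_ embed
    embed-injective =
      ι-injective ∘ transpose-injective (ι w) (Edge.v e₀) ∘ transpose-injective (ι a) (Edge.u e₀)

    private
      a≢w : a ≢ w
      a≢w = adj⇒≢ H w~a ∘ sym

      v₀≢u₀ : Edge.v e₀ ≢ Edge.u e₀
      v₀≢u₀ eq = <⇒≢ i<j (trans (sym toℕ-u₀) (trans (cong toℕ (sym eq)) toℕ-v₀))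

      first-fixes : ∀ {c} → c ≢ w → transpose (ι w) (Edge.v e₀) (ι c) ≡ ι c
      first-fixes c≢w = transpose-mismatch (c≢w ∘ ι-injective) (ι≢v₀ c≢w)

    embed-w : embed w ≡ Edge.v e₀
    embed-w = trans (cong (transpose (ι a) (Edge.u e₀)) (transpose-matchˡ (ι w) (Edge.v e₀)))
                    (transpose-mismatch (ι≢v₀ a≢w ∘ sym) v₀≢u₀)

    embed-a : embed a ≡ Edge.u e₀
    embed-a = trans (cong (transpose (ι a) (Edge.u e₀)) (first-fixes a≢w))
                    (transpose-matchˡ (ι a) (Edge.u e₀))

    embed-<j : ∀ {c} → c ≢ w → toℕ (embed c) < j
    embed-<j {c} c≢w rewrite first-fixes c≢w with transpose-cases (ι a) (Edge.u e₀) (ι c)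
    ... | inj₁ eq        = subst (_< j) (sym (trans (cong toℕ eq) toℕ-u₀)) i<j
    ... | inj₂ (inj₁ eq) = subst (_< j) (sym (cong toℕ eq)) (ι-<j a≢w)
    ... | inj₂ (inj₂ eq) = subst (_< j) (sym (cong toℕ eq)) (ι-<j c≢w)

    embed-neighbour : i ∉ freePositions → ∀ {c} → adj H w c ≡ true → c ≢ a →
      toℕ (embed c) ∈ freePositions
    embed-neighbour i∉ {c} w~c c≢a =
      subst (_∈ freePositions) (sym (trans (cong toℕ embed≡ι) (toℕ-ι c))) c∈
      where
      c∈ : position c ∈ freePositions
      c∈ = ∈-freePositions w~c c≢a
      ι≢u₀ : ι c ≢ Edge.u e₀
      ι≢u₀ eq = i∉ (subst (_∈ freePositions) (trans (sym (toℕ-ι c)) (trans (cong toℕ eq) toℕ-u₀)) c∈)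
      embed≡ι : embed c ≡ ι c
      embed≡ι = trans (cong (transpose (ι a) (Edge.u e₀)) (first-fixes (adj⇒≢ H w~c ∘ sym)))
                      (transpose-mismatch (c≢a ∘ ι-injective) ι≢u₀)

    copy-spans : i ∉ freePositions →
      CircuitSpans M (Below j ∪ Column j (_∈ freePositions)) (edgeAt i<j j<n)
    copy-spans i∉ = copyOf H embed , hM embed embed-injective _ (copyOf-isCopy H embed) , e₀∈copy , copy⊆
      where
      e₀∈copy : e₀ ∈ₑ copyOf H embed
      e₀∈copy = from (copyOf-isCopy H embed e₀)
                     (a , w , trans (SimpleGraph.sym H a w) w~a , embed-a , embed-w)

      copy⊆ : (_∈ₑ copyOf H embed) ⊆′ (Below j ∪ Column j (_∈ freePositions)) ∪ ｛ e₀ ｝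
      copy⊆ e e∈ = let x , y , x~y , x↦u , y↦v = to (copyOf-isCopy H embed e) e∈ in
        place x~y x↦u y↦v (y ≟ᶠ w) (x ≟ᶠ a)
        where
        place : ∀ {x y} → adj H x y ≡ true → embed x ≡ Edge.u e → embed y ≡ Edge.v e →
          Dec (y ≡ w) → Dec (x ≡ a) → ((Below j ∪ Column j (_∈ freePositions)) ∪ ｛ e₀ ｝) e
        place _ _ y↦v (no y≢w) _ = inj₁ (inj₁ (subst (_< j) (cong toℕ y↦v) (embed-<j y≢w)))
        place _ x↦u y↦v (yes refl) (yes refl) =
          inj₂ (edge-≡ (trans (sym embed-a) x↦u) (trans (sym embed-w) y↦v))
        place {x} x~w x↦u y↦v (yes refl) (no x≢a) = inj₁ (inj₂ (v≡j , u∈free))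
          where
          v≡j : toℕ (Edge.v e) ≡ j
          v≡j = trans (cong toℕ (sym y↦v)) (trans (cong toℕ embed-w) toℕ-v₀)
          u∈free : toℕ (Edge.u e) ∈ freePositions
          u∈free = subst (_∈ freePositions) (cong toℕ x↦u)
                         (embed-neighbour i∉ (trans (SimpleGraph.sym H w x) x~w) x≢a)

  module _ {n : ℕ} (M : Matroid n) (hM : IsHMatroid H M) where

    -- Indexed by k + s′ rather than s′ + k so that suc k + s′ reduces to suc (k + s′).
    rankOn-Below-HMatroid : ∀ k → k + s′ ≤ n →
      RankAtMostOn M (Below (k + s′)) (k * length freePositions + s′ C 2)
    rankOn-Below-HMatroid zero s′≤n = rankOn-Below M s′ s′≤n
    rankOn-Below-HMatroid (suc k) j<n =
      rankOn-spannedColumn M j<n (λ i<j → copy-spans M hM i<j j<n (m≤n+m s′ k))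
        (rankOn-mono M (λ _ → id) (≤-reflexive reorder)
          (rankOn-addColumn M j<n freePositions (rankOn-Below-HMatroid k (<⇒≤ j<n))))
      where
      d : ℕ
      d = length freePositions
      reorder : k * d + s′ C 2 + d ≡ suc k * d + s′ C 2
      reorder = trans (+-comm (k * d + s′ C 2) d) (sym (+-assoc d (k * d) (s′ C 2)))

    rankAtMost-HMatroid : ∀ {d} → length freePositions ≤ d → s′ ≤ n →
      RankAtMost M (d * (n ∸ s′) + s′ C 2)
    rankAtMost-HMatroid {d} free≤d s′≤n = rankAtMost-Below M
      (rankOn-mono M below-n bound (rankOn-Below-HMatroid (n ∸ s′) (≤-reflexive (m∸n+n≡m s′≤n))))
      where
      below-n : Below n ⊆′ Below (n ∸ s′ + s′)
      below-n e = subst (toℕ (Edge.v e) <_) (sym (m∸n+n≡m s′≤n))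
      bound : (n ∸ s′) * length freePositions + s′ C 2 ≤ d * (n ∸ s′) + s′ C 2
      bound = +-monoˡ-≤ (s′ C 2) (≤-trans (*-monoʳ-≤ (n ∸ s′) free≤d) (≤-reflexive (*-comm (n ∸ s′) d)))

lemma3p6 : (s δ n : ℕ) (H : SimpleGraph s) → IsMinDegree H δ → 1 ≤ δ →
    (M : Matroid n) → IsHMatroid H M → s ∸ 1 ≤ n →
    RankAtMost M ((δ ∸ 1) * (suc n ∸ s) + (s ∸ 1) C 2)
lemma3p6 zero _ _ _ ((() , _) , _)
lemma3p6 (suc s′) zero _ _ _ ()
lemma3p6 (suc s′) (suc d) n H ((w , degree≡) , _) _ M hM s′≤n
  with _ , w~a ← filterᵇ-nonempty (allFin (suc s′)) (subst (0 <_) (sym degree≡) (s≤s z≤n)) =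
  rankAtMost-HMatroid H w~a M hM
    (s≤s⁻¹ (subst (length (freePositions H w~a) <_) degree≡ (length-freePositions H w~a))) s′≤n
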